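{- Let $G$ be a finite connected bipartite graph with at least one edge and $H$ a finite connected simple graph with at least one edge. (1) If $H$ is bipartite, then the number of connected components of $\mathrm{Hom}(G,H)$ containing a graph homomorphism $f\colon G\to H$ which induces the trivial map $\pi_1(G)\to\pi_1(H)$ is $2$. (2) If $H$ is non-bipartite, this number is $1$.
   Context: Graphs are sets $V$ with symmetric $E\subseteq V\times V$, regarded as 1-dimensional complexes; $\pi_1$ is the ordinary fundamental group. A multi-homomorphism is a map $\eta\colon V(G)\to\mathcal{P}(V(H))\setminus\{\emptyset\}$ with $\eta(x)\times\eta(y)\subseteq E(H)$ for every edge $(x,y)$ of $G$; $\mathrm{Hom}(G,H)$ is the poset of multi-homomorphisms under pointwise inclusion, topologized via the geometric realization of its order complex; a graph homomorphism $f$ is identified with $x\mapsto\{f(x)\}$. -}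

module Defs where

open import Data.Nat using (ℕ)
open import Data.Fin using (Fin)
open import Data.Fin.Subset using (Subset; _∈_; _⊆_; ⁅_⁆; Nonempty)
open import Data.Bool using (Bool; T)
open import Data.Product using (Σ; ∃; ∃₂; _×_)
open import Relation.Nullary using (¬_)
open import Relation.Binary.PropositionalEquality using (_≡_; _≢_)
open import Relation.Binary.Construct.Closure.Equivalence using (EqClosure)

record Graph : Set where
  field
    n   : ℕ
    adj : Fin n → Fin n → Bool
    adj-sym : ∀ x y → adj x y ≡ adj y x
open Graph public

V : Graph → Set
V G = Fin (n G)

Edge : (G : Graph) → V G → V G → Set
Edge G x y = T (adj G x y)

data Walk (G : Graph) : V G → V G → Set where
  nil  : ∀ {x} → Walk G x x
  cons : ∀ {x y z} → Edge G x y → Walk G y z → Walk G x z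

Connected : Graph → Set
Connected G = ∀ (x y : V G) → Walk G x y

Bipartite : Graph → Set
Bipartite G = Σ (V G → Bool) λ c → ∀ x y → Edge G x y → c x ≢ c y

Simple : Graph → Set
Simple G = ∀ x → ¬ Edge G x x

HasEdge : Graph → Set
HasEdge G = ∃₂ λ x y → Edge G x y

data Step (G : Graph) : ∀ {x z} → Walk G x z → Walk G x z → Set where
  here  : ∀ {x y z} (e : Edge G x y) (e' : Edge G y x) (w : Walk G x z) →
          Step G (cons e (cons e' w)) w
  later : ∀ {x y z} (e : Edge G x y) {w w' : Walk G y z} →
          Step G w w' → Step G (cons e w) (cons e w')

-- Edge-path homotopy (combinatorial model of homotopy rel endpoints).
Homotopic : (G : Graph) {x z : V G} → Walk G x z → Walk G x z → Set
Homotopic G {x} {z} = EqClosure (Step G {x} {z})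

record GraphHom (G H : Graph) : Set where
  field
    fun : V G → V H
    pres : ∀ x y → Edge G x y → Edge H (fun x) (fun y)
open GraphHom public

mapWalk : ∀ {G H} (f : GraphHom G H) {x y} → Walk G x y → Walk H (fun f x) (fun f y)
mapWalk f nil = nil
mapWalk {G} f (cons {x} {y} e w) = cons (pres f x y e) (mapWalk f w)

InducesTrivialπ₁ : ∀ {G H} → GraphHom G H → Set
InducesTrivialπ₁ {G} {H} f = ∀ (x : V G) (w : Walk G x x) → Homotopic H (mapWalk f w) nil

-- Multi-homomorphisms (elements of Hom(G,H)).
record MultiHom (G H : Graph) : Set where
  field
    η        : V G → Subset (n H)
    nonempty : ∀ x → Nonempty (η x)
    edges    : ∀ x y → Edge G x y → ∀ a b → a ∈ η x → b ∈ η y → Edge H a b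
open MultiHom public

_≤M_ : ∀ {G H} → MultiHom G H → MultiHom G H → Set
_≤M_ {G} η₁ η₂ = ∀ (x : V G) → η η₁ x ⊆ η η₂ x

-- Same connected component of (the realization of the order complex of) Hom(G,H):
-- the equivalence relation generated by comparability.
SameComponent : ∀ {G H} → MultiHom G H → MultiHom G H → Set
SameComponent = EqClosure _≤M_

single : ∀ {G H} → GraphHom G H → MultiHom G H
single {G} {H} f = record
  { η = λ x → ⁅ fun f x ⁆
  ; nonempty = λ x → fun f x , x∈⁅x⁆ (fun f x)
  ; edges = λ x y e a b a∈ b∈ → helper x y e a b a∈ b∈ }
  where
  open import Data.Fin.Subset.Properties using (x∈⁅x⁆; x∈⁅y⁆⇒x≡y)
  open import Data.Product using (_,_)
  open import Relation.Binary.PropositionalEquality using (subst₂; sym)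
  helper : ∀ x y → Edge G x y → ∀ a b → a ∈ ⁅ fun f x ⁆ → b ∈ ⁅ fun f y ⁆ → Edge H a b
  helper x y e a b a∈ b∈ =
    subst₂ (Edge H) (sym (x∈⁅y⁆⇒x≡y _ a∈)) (sym (x∈⁅y⁆⇒x≡y _ b∈)) (pres f x y e)

-- "The number of connected components of Hom(G,H) containing a graph
-- homomorphism inducing the trivial map on π₁ is k":
-- there are k such homomorphisms lying in pairwise distinct components,
-- and every such homomorphism lies in one of their components.
NumTrivialComponents : (G H : Graph) → ℕ → Set
NumTrivialComponents G H k =
  Σ (Fin k → GraphHom G H) λ g →
    (∀ i → InducesTrivialπ₁ (g i)) ×
    (∀ i j → i ≢ j → ¬ SameComponent (single (g i)) (single (g j))) ×
    (∀ (f : GraphHom G H) → InducesTrivialπ₁ f →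
       ∃ λ i → SameComponent (single f) (single (g i)))

-- A homomorphism f : G → H that is trivial on π₁ lifts to the universal cover of H, a tree.
-- Two homomorphisms agreeing at one end of every edge of G lie in one component of Hom(G, H),
-- so folding the deepest level of the tree onto the level two below does not leave the
-- component, and doing so repeatedly connects f to a map G → K₂ → H onto a single edge.
-- Sliding one end of that edge at a time connects it to a fixed edge a b, in the orientation
-- given by the parity of the walk travelled. If H has an odd closed walk the two orientations
-- are connected; if H is bipartite, the colour of the image of a vertex of G separates them.

module Submission where

open import Defs
open import Data.Bool using (Bool; true; false; T; not; if_then_else_)
open import Data.Bool.Properties
  using (T-irrelevant; ¬-not; not-injective; not-involutive) renaming (_≟_ to _≟ᵇ_)
open import Data.Empty using (⊥; ⊥-elim)
open import Data.Fin using (Fin; zero; suc)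
open import Data.Fin.Properties using (any?) renaming (_≟_ to _≟ᶠ_)
open import Data.Fin.Subset using (Subset; _∈_; _∪_; ⁅_⁆)
open import Data.Fin.Subset.Properties
  using (x∈⁅x⁆; x∈⁅y⁆⇒x≡y; x∈p∪q⁻; p⊆p∪q; q⊆p∪q)
open import Data.List using (List; []; _∷_; length; tabulate)
open import Data.List.Extrema.Nat using (max; xs≤max)
open import Data.List.Membership.Propositional.Properties using (∈-tabulate⁺)
import Data.List.Relation.Unary.All as All
open import Data.Nat using (ℕ; zero; suc; _≤_; s≤s; z≤n) renaming (_≟_ to _≟ⁿ_)
open import Data.Nat.Properties
  using (≤-trans; ≤-pred; ≤∧≢⇒<; ≤-reflexive; n≤1+n; m≤n+m; 1+n≰n; suc-injective)
open import Data.Product using (Σ; ∃; ∃₂; _×_; _,_; proj₁; proj₂)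
open import Data.Sum as Sum using (_⊎_; inj₁; inj₂; swap)
open import Data.Unit using (⊤; tt)
open import Function using (_∘_; id)
open import Relation.Nullary using (¬_; yes; no)
open import Relation.Nullary.Decidable using (T?; _×-dec_)
open import Relation.Binary.PropositionalEquality
open import Relation.Binary.Construct.Closure.Equivalence using (gmap; gfold; symmetric; transitive)
open import Relation.Binary.Construct.Closure.ReflexiveTransitive using (ε; _◅_)
open import Relation.Binary.Construct.Closure.Symmetric using (fwd; bwd)

Edge-sym : (K : Graph) {x y : V K} → Edge K x y → Edge K y x
Edge-sym K {x} {y} = subst T (adj-sym K x y)

ProperColouring : (K : Graph) → (V K → Bool) → Set
ProperColouring K c = ∀ x y → Edge K x y → c x ≢ c y

module _ {K : Graph} where

  infixr 5 _++_ _ʳ++_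

  _++_ : ∀ {x y z} → Walk K x y → Walk K y z → Walk K x z
  nil      ++ q = q
  cons e p ++ q = cons e (p ++ q)

  _ʳ++_ : ∀ {x y z} → Walk K x y → Walk K x z → Walk K y z
  nil      ʳ++ q = q
  cons e p ʳ++ q = p ʳ++ cons (Edge-sym K e) q

  parity : ∀ {x y} → Walk K x y → Bool
  parity nil        = false
  parity (cons _ w) = not (parity w)

  AllVertices : (V K → Set) → ∀ {x y} → Walk K x y → Set
  AllVertices P (nil {x})      = P x
  AllVertices P (cons {x} _ w) = P x × AllVertices P w

  AllVertices-first : ∀ {P x y} (w : Walk K x y) → AllVertices P w → P x
  AllVertices-first nil        px       = px
  AllVertices-first (cons _ _) (px , _) = px

  AllVertices-last : ∀ {P x y} (w : Walk K x y) → AllVertices P w → P y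
  AllVertices-last nil        py       = py
  AllVertices-last (cons _ w) (_ , pw) = AllVertices-last w pw

  cons-homotopic : ∀ {x y z} (e : Edge K x y) {w w' : Walk K y z} →
                   Homotopic K w w' → Homotopic K (cons e w) (cons e w')
  cons-homotopic e = gmap (cons e) (later e)

module _ {G H : Graph} (f : GraphHom G H) where

  mapWalk-++ : ∀ {x y z} (p : Walk G x y) (q : Walk G y z) →
               mapWalk f (p ++ q) ≡ mapWalk f p ++ mapWalk f q
  mapWalk-++ nil        q = refl
  mapWalk-++ (cons e p) q = cong (cons _) (mapWalk-++ p q)

  mapWalk-ʳ++ : ∀ {x y z} (p : Walk G x y) (q : Walk G x z) →
                mapWalk f (p ʳ++ q) ≡ mapWalk f p ʳ++ mapWalk f q
  mapWalk-ʳ++ nil        q = refl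
  mapWalk-ʳ++ (cons e p) q = trans (mapWalk-ʳ++ p _)
    (cong (λ e' → mapWalk f p ʳ++ cons e' (mapWalk f q)) (T-irrelevant _ _))

module _ (K : Graph) where

  not-proper : ∀ {c} → ProperColouring K c → ProperColouring K (not ∘ c)
  not-proper c-proper x y e = c-proper x y e ∘ not-injective

  proper-colourings-agree : ∀ {c c'} → ProperColouring K c → ProperColouring K c' →
                            ∀ {x y} → Walk K x y → c x ≡ c' x → c y ≡ c' y
  proper-colourings-agree c-proper c'-proper nil eq = eq
  proper-colourings-agree {c} {c'} c-proper c'-proper (cons {x} {z} e w) eq =
    proper-colourings-agree c-proper c'-proper w (begin
      c z        ≡⟨ ¬-not (c-proper z x (Edge-sym K e)) ⟩
      not (c x)  ≡⟨ cong not eq ⟩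
      not (c' x) ≡⟨ sym (¬-not (c'-proper z x (Edge-sym K e))) ⟩
      c' z       ∎)
    where open ≡-Reasoning

  monochromatic-edge : (c : V K → Bool) → ¬ ProperColouring K c →
                       ∃₂ λ x y → Edge K x y × c x ≡ c y
  monochromatic-edge c improper
    with any? (λ x → any? (λ y → T? (adj K x y) ×-dec (c x ≟ᵇ c y)))
  ... | yes (x , y , e , eq) = x , y , e , eq
  ... | no none = ⊥-elim (improper λ x y e eq → none (x , y , e , eq))

module _ {A : Set} where

  infix 4 _⋖_

  _⋖_ : List A → List A → Set
  s ⋖ t = ∃ λ u → t ≡ u ∷ s

  Neighbours : List A → List A → Set
  Neighbours s t = s ⋖ t ⊎ t ⋖ s

-- A walk ending at a is recorded as a ∷ r, r listing its earlier vertices, latest first.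
-- move a y r appends the edge a → y, cancelling a backtrack, so reduce computes reduced walks;
-- the non-backtracking chains to v0 are the vertices of the universal cover of K at v0.
module UniversalCover (K : Graph) where

  move : V K → V K → List (V K) → List (V K)
  move a y []      = a ∷ []
  move a y (t ∷ r) with y ≟ᶠ t
  ... | yes _ = r
  ... | no  _ = a ∷ t ∷ r

  NonBacktracking : List (V K) → Set
  NonBacktracking (u ∷ w ∷ t ∷ r) = u ≢ t × NonBacktracking (w ∷ t ∷ r)
  NonBacktracking _               = ⊤

  ChainTo : V K → List (V K) → Set
  ChainTo v0 []          = ⊥
  ChainTo v0 (u ∷ [])    = u ≡ v0
  ChainTo v0 (u ∷ w ∷ r) = Edge K u w × ChainTo v0 (w ∷ r)

  move-pop : ∀ y a r → move y a (a ∷ r) ≡ r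
  move-pop y a r with a ≟ᶠ a
  ... | yes _   = refl
  ... | no  a≢a = ⊥-elim (a≢a refl)

  move-move : ∀ a y r → NonBacktracking (a ∷ r) → move y a (move a y r) ≡ r
  move-move a y []      _  = move-pop y a []
  move-move a y (t ∷ r) nb with y ≟ᶠ t
  move-move a y (.y ∷ [])    nb | yes refl = refl
  move-move a y (.y ∷ s ∷ r) nb | yes refl with a ≟ᶠ s
  ... | yes a≡s = ⊥-elim (proj₁ nb a≡s)
  ... | no  _   = refl
  move-move a y (t ∷ r) nb | no _ = move-pop y a (t ∷ r)

  move-nonBacktracking : ∀ a y r → NonBacktracking (a ∷ r) → NonBacktracking (y ∷ move a y r)
  move-nonBacktracking a y []      _  = tt
  move-nonBacktracking a y (t ∷ r) nb with y ≟ᶠ t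
  move-nonBacktracking a y (.y ∷ [])    nb | yes refl = tt
  move-nonBacktracking a y (.y ∷ s ∷ r) nb | yes refl = proj₂ nb
  ... | no y≢t = y≢t , nb

  move-chain : ∀ {v0 a y} r → Edge K a y → ChainTo v0 (a ∷ r) → ChainTo v0 (y ∷ move a y r)
  move-chain []      ay ch = Edge-sym K ay , ch
  move-chain {y = y} (t ∷ r) ay ch with y ≟ᶠ t
  ... | yes refl = proj₂ ch
  ... | no  _    = Edge-sym K ay , ch

  move-neighbours : ∀ a y r → Neighbours (a ∷ r) (y ∷ move a y r)
  move-neighbours a y []      = inj₁ (y , refl)
  move-neighbours a y (t ∷ r) with y ≟ᶠ t
  ... | yes refl = inj₂ (a , refl)
  ... | no  _    = inj₁ (y , refl)

  reduce : ∀ {a b} → List (V K) → Walk K a b → List (V K)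
  reduce     r nil                = r
  reduce {a} r (cons {y = y} _ w) = reduce (move a y r) w

  reduce-++ : ∀ {a b c} r (p : Walk K a b) (q : Walk K b c) →
              reduce r (p ++ q) ≡ reduce (reduce r p) q
  reduce-++     r nil                q = refl
  reduce-++ {a} r (cons {y = y} _ p) q = reduce-++ (move a y r) p q

  reduce-preserves : (P : V K → List (V K) → Set) →
                     (∀ {a y} r → Edge K a y → P a r → P y (move a y r)) →
                     ∀ {a b} r (w : Walk K a b) → P a r → P b (reduce r w)
  reduce-preserves P move-P r nil        pr = pr
  reduce-preserves P move-P r (cons e w) pr = reduce-preserves P move-P _ w (move-P r e pr)

  reduce-step : ∀ {a b} r {w w' : Walk K a b} → NonBacktracking (a ∷ r) →
                Step K w w' → reduce r w ≡ reduce r w'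
  reduce-step {a} r nb (here {y = y} _ _ w) = cong (λ s → reduce s w) (move-move a y r nb)
  reduce-step {a} r nb (later {y = y} _ st) =
    reduce-step (move a y r) (move-nonBacktracking a y r nb) st

  reduce-homotopic : ∀ {a b} r {w w' : Walk K a b} → NonBacktracking (a ∷ r) →
                     Homotopic K w w' → reduce r w ≡ reduce r w'
  reduce-homotopic r nb = gfold isEquivalence (reduce r) (reduce-step r nb)

  reduce-ʳ++ : ∀ {a b c} r (q : Walk K a b) (acc : Walk K a c) → NonBacktracking (a ∷ r) →
               reduce (reduce r q) (q ʳ++ acc) ≡ reduce r acc
  reduce-ʳ++     r nil                acc nb = refl
  reduce-ʳ++ {a} r (cons {y = y} e q) acc nb =
    trans (reduce-ʳ++ (move a y r) q (cons (Edge-sym K e) acc) (move-nonBacktracking a y r nb))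
          (cong (λ s → reduce s acc) (move-move a y r nb))

  reduce-injective : ∀ {a b r r'} (w : Walk K a b) →
                     NonBacktracking (a ∷ r) → NonBacktracking (a ∷ r') →
                     reduce r w ≡ reduce r' w → r ≡ r'
  reduce-injective {r = r} {r'} w nb nb' eq = begin
    r                                ≡⟨ sym (reduce-ʳ++ r w nil nb) ⟩
    reduce (reduce r w) (w ʳ++ nil)  ≡⟨ cong (λ s → reduce s (w ʳ++ nil)) eq ⟩
    reduce (reduce r' w) (w ʳ++ nil) ≡⟨ reduce-ʳ++ r' w nil nb' ⟩
    r'                               ∎
    where open ≡-Reasoning

module _ {A : Set} where

  isRoot : List A → Bool
  isRoot (_ ∷ []) = true
  isRoot _        = false

  -- Read as reversed walks, prune M removes the last two edges of the walks of length 2 + M.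
  prune : ℕ → List A → List A
  prune M (u ∷ w ∷ t ∷ r) with length (t ∷ r) ≟ⁿ suc M
  ... | yes _ = t ∷ r
  ... | no  _ = u ∷ w ∷ t ∷ r
  prune M l = l

  prune-short : ∀ M l → length l ≤ suc (suc M) → prune M l ≡ l
  prune-short M []              _ = refl
  prune-short M (_ ∷ [])        _ = refl
  prune-short M (_ ∷ _ ∷ [])    _ = refl
  prune-short M (u ∷ w ∷ t ∷ r) l≤2+M with length (t ∷ r) ≟ⁿ suc M
  ... | yes eq = ⊥-elim (1+n≰n (subst (λ k → suc (suc k) ≤ suc (suc M)) eq l≤2+M))
  ... | no  _  = refl

  prune-height : ∀ M l → length l ≤ suc (suc (suc M)) → length (prune M l) ≤ suc (suc M)
  prune-height M []              _ = z≤n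
  prune-height M (_ ∷ [])        _ = s≤s z≤n
  prune-height M (_ ∷ _ ∷ [])    _ = s≤s (s≤s z≤n)
  prune-height M (u ∷ w ∷ t ∷ r) l≤3+M with length (t ∷ r) ≟ⁿ suc M
  ... | yes eq = ≤-trans (≤-reflexive eq) (n≤1+n (suc M))
  ... | no  ne = ≤-pred (≤∧≢⇒< l≤3+M (ne ∘ suc-injective ∘ suc-injective))

module _ {G H : Graph} where

  infix 4 _~_

  _~_ : GraphHom G H → GraphHom G H → Set
  f ~ g = SameComponent (single f) (single g)

  ~-sym : ∀ {f g} → f ~ g → g ~ f
  ~-sym = symmetric _≤M_

  ~-trans : ∀ {f g h} → f ~ g → g ~ h → f ~ h
  ~-trans = transitive _≤M_

  AgreeOnEdges : GraphHom G H → GraphHom G H → Set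
  AgreeOnEdges f g = ∀ x y → Edge G x y → fun f x ≡ fun g x ⊎ fun f y ≡ fun g y

  module _ {f g : GraphHom G H} (agree : AgreeOnEdges f g) where

    private
      pair : V G → Subset (n H)
      pair x = ⁅ fun f x ⁆ ∪ ⁅ fun g x ⁆

      ∈-pair : ∀ {x v} → v ∈ pair x → v ≡ fun f x ⊎ v ≡ fun g x
      ∈-pair {x} v∈ with x∈p∪q⁻ ⁅ fun f x ⁆ ⁅ fun g x ⁆ v∈
      ... | inj₁ v∈f = inj₁ (x∈⁅y⁆⇒x≡y _ v∈f)
      ... | inj₂ v∈g = inj₂ (x∈⁅y⁆⇒x≡y _ v∈g)

      edge-from-agreeing : ∀ x y → Edge G x y → fun f x ≡ fun g x →
                           ∀ {u v} → u ∈ pair x → v ∈ pair y → Edge H u v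
      edge-from-agreeing x y e fx≡gx u∈ v∈ with ∈-pair u∈ | ∈-pair v∈
      ... | inj₁ refl | inj₁ refl = pres f x y e
      ... | inj₂ refl | inj₂ refl = pres g x y e
      ... | inj₁ refl | inj₂ refl = subst (λ u → Edge H u _) (sym fx≡gx) (pres g x y e)
      ... | inj₂ refl | inj₁ refl = subst (λ u → Edge H u _) fx≡gx (pres f x y e)

      union : MultiHom G H
      union = record
        { η        = pair
        ; nonempty = λ x → fun f x , p⊆p∪q ⁅ fun g x ⁆ (x∈⁅x⁆ (fun f x))
        ; edges    = edges-union
        }
        where
        edges-union : ∀ x y → Edge G x y → ∀ u v → u ∈ pair x → v ∈ pair y → Edge H u v
        edges-union x y e u v u∈ v∈ with agree x y e
        ... | inj₁ fx≡gx = edge-from-agreeing x y e fx≡gx u∈ v∈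
        ... | inj₂ fy≡gy = Edge-sym H (edge-from-agreeing y x (Edge-sym G e) fy≡gy v∈ u∈)

    agreeOnEdges⇒~ : f ~ g
    agreeOnEdges⇒~ = _◅_ {j = union} (fwd f≤union) (bwd g≤union ◅ ε)
      where
      f≤union : single f ≤M union
      f≤union x = p⊆p∪q ⁅ fun g x ⁆
      g≤union : single g ≤M union
      g≤union x = q⊆p∪q ⁅ fun f x ⁆ ⁅ fun g x ⁆

  agreeOnColourClass⇒~ : ∀ {c} → ProperColouring G c → ∀ k {f g} →
                         (∀ x → c x ≡ k → fun f x ≡ fun g x) → f ~ g
  agreeOnColourClass⇒~ {c} c-proper k {f} {g} agree = agreeOnEdges⇒~ agree-on-edges
    where
    agree-on-edges : AgreeOnEdges f g
    agree-on-edges x y e with c x ≟ᵇ k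
    ... | yes cx≡k = inj₁ (agree x cx≡k)
    ... | no  cx≢k = inj₂ (agree y (begin
      c y             ≡⟨ ¬-not (c-proper y x (Edge-sym G e)) ⟩
      not (c x)       ≡⟨ cong not (¬-not cx≢k) ⟩
      not (not k)     ≡⟨ not-involutive k ⟩
      k               ∎))
      where open ≡-Reasoning

OnPair : {A : Set} → A → A → A → Set
OnPair p q v = v ≡ p ⊎ v ≡ q

module _ {K : Graph} (simple : Simple K) (p q : V K) where

  private
    pair-pigeonhole : ∀ {x y z} → OnPair p q x → OnPair p q y → OnPair p q z →
                      x ≢ y → y ≢ z → x ≢ z → ⊥
    pair-pigeonhole (inj₁ refl) (inj₁ refl) _           x≢y _   _   = x≢y refl
    pair-pigeonhole (inj₂ refl) (inj₂ refl) _           x≢y _   _   = x≢y refl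
    pair-pigeonhole (inj₁ refl) (inj₂ refl) (inj₁ refl) _   _   x≢z = x≢z refl
    pair-pigeonhole (inj₁ refl) (inj₂ refl) (inj₂ refl) _   y≢z _   = y≢z refl
    pair-pigeonhole (inj₂ refl) (inj₁ refl) (inj₁ refl) _   y≢z _   = y≢z refl
    pair-pigeonhole (inj₂ refl) (inj₁ refl) (inj₂ refl) _   _   x≢z = x≢z refl

    edge-≢ : ∀ {x y} → Edge K x y → x ≢ y
    edge-≢ {x} e refl = simple x e

  closedWalk-onPair-null : ∀ {x} (w : Walk K x x) → AllVertices (OnPair p q) w →
                           Homotopic K w nil
  openWalk-onPair-edge : ∀ {x y} (w : Walk K x y) → AllVertices (OnPair p q) w → x ≢ y →
                         Σ (Edge K x y) λ e → Homotopic K w (cons e nil)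

  closedWalk-onPair-null nil        _        = ε
  closedWalk-onPair-null (cons e w) (_ , on) with openWalk-onPair-edge w on (edge-≢ e ∘ sym)
  ... | e' , w~e' = transitive _ (cons-homotopic e w~e') (fwd (here e e' nil) ◅ ε)

  openWalk-onPair-edge nil _ x≢x = ⊥-elim (x≢x refl)
  openWalk-onPair-edge {y = y} (cons {y = x'} e w) (on-x , on) x≢y with x' ≟ᶠ y
  ... | yes refl = e , cons-homotopic e (closedWalk-onPair-null w on)
  ... | no  x'≢y = ⊥-elim (pair-pigeonhole on-x (AllVertices-first w on) (AllVertices-last w on)
                                           (edge-≢ e) x'≢y x≢y)

module EdgeMaps {G H : Graph} (c : V G → Bool) (c-proper : ProperColouring G c) where

  toEdge : ∀ p q → Edge H p q → GraphHom G H
  toEdge p q e = record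
    { fun  = λ x → if c x then p else q
    ; pres = λ x y xy → if-edge (c x) (c y) (c-proper x y xy)
    }
    where
    if-edge : ∀ bx by → bx ≢ by → Edge H (if bx then p else q) (if by then p else q)
    if-edge true  true  t≢t = ⊥-elim (t≢t refl)
    if-edge true  false _   = e
    if-edge false true  _   = Edge-sym H e
    if-edge false false f≢f = ⊥-elim (f≢f refl)

  toEdge-true : ∀ {p q} (e : Edge H p q) {x} → c x ≡ true → fun (toEdge p q e) x ≡ p
  toEdge-true e cx≡true = cong (λ b → if b then _ else _) cx≡true

  toEdge-false : ∀ {p q} (e : Edge H p q) {x} → c x ≡ false → fun (toEdge p q e) x ≡ q
  toEdge-false e cx≡false = cong (λ b → if b then _ else _) cx≡false

  toEdge-slideʳ : ∀ {p q q'} (e : Edge H p q) (e' : Edge H p q') → toEdge p q e ~ toEdge p q' e'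
  toEdge-slideʳ e e' = agreeOnColourClass⇒~ c-proper true λ x cx≡true →
    trans (toEdge-true e cx≡true) (sym (toEdge-true e' cx≡true))

  toEdge-slideˡ : ∀ {p p' q} (e : Edge H p q) (e' : Edge H p' q) → toEdge p q e ~ toEdge p' q e'
  toEdge-slideˡ e e' = agreeOnColourClass⇒~ c-proper false λ x cx≡false →
    trans (toEdge-false e cx≡false) (sym (toEdge-false e' cx≡false))

  toEdge-trivialπ₁ : Simple H → ∀ {p q} (e : Edge H p q) → InducesTrivialπ₁ (toEdge p q e)
  toEdge-trivialπ₁ simple {p} {q} e x w = closedWalk-onPair-null simple p q _ (onPair w)
    where
    if-onPair : ∀ b → OnPair p q (if b then p else q)
    if-onPair true  = inj₁ refl
    if-onPair false = inj₂ refl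

    onPair : ∀ {x y} (w : Walk G x y) → AllVertices (OnPair p q) (mapWalk (toEdge p q e) w)
    onPair (nil {x})      = if-onPair (c x)
    onPair (cons {x} _ w) = if-onPair (c x) , onPair w

  -- Since all of η x0 is adjacent to all of η y0, the d-colour of η x0 is constant along ≤M.
  toEdge-flip-separated : ∀ {d} → ProperColouring H d → ∀ {x0 y0} → Edge G x0 y0 →
                          ∀ {p q} (e : Edge H p q) (e' : Edge H q p) →
                          ¬ toEdge p q e ~ toEdge q p e'
  toEdge-flip-separated {d} d-proper {x0} {y0} x0y0 {p} {q} e e' pq~qp =
    flip-colours (c x0) (gfold isEquivalence colourAt (λ {m} {m'} → colourAt-≤ {m} {m'}) pq~qp)
    where
    colourAt : MultiHom G H → Bool
    colourAt m = d (proj₁ (nonempty m x0))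

    colourAt-≤ : ∀ {m m'} → m ≤M m' → colourAt m ≡ colourAt m'
    colourAt-≤ {m} {m'} m≤m' =
      trans (¬-not (d-proper _ _ (edge (m≤m' x0 (proj₂ (nonempty m x0))))))
            (sym (¬-not (d-proper _ _ (edge (proj₂ (nonempty m' x0))))))
      where
      edge : ∀ {u} → u ∈ η m' x0 → Edge H u (proj₁ (nonempty m' y0))
      edge u∈ = edges m' x0 y0 x0y0 _ _ u∈ (proj₂ (nonempty m' y0))

    flip-colours : ∀ b → d (if b then p else q) ≢ d (if b then q else p)
    flip-colours true  = d-proper p q e
    flip-colours false = d-proper p q e ∘ sym

  module _ {a b : V H} (ab : Edge H a b) where

    base : Bool → GraphHom G H
    base false = toEdge a b ab
    base true  = toEdge b a (Edge-sym H ab)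

    -- Walking p → a alternately slides the two ends of the edge, so the orientation in
    -- which it arrives at a b is the parity of the walk.
    toEdge~base : ∀ {p} (w : Walk H p a) →
                  (∀ {q} (e : Edge H p q) → toEdge p q e ~ base (parity w)) ×
                  (∀ {q} (e : Edge H q p) → toEdge q p e ~ base (not (parity w)))
    toEdge~base nil = (λ e → toEdge-slideʳ e ab) , (λ e → toEdge-slideˡ e (Edge-sym H ab))
    toEdge~base (cons pp' w) =
      (λ e → ~-trans (toEdge-slideʳ e pp') (proj₂ (toEdge~base w) pp')) ,
      (λ e → ~-trans (toEdge-slideˡ e (Edge-sym H pp'))
                     (subst (λ k → _ ~ base k) (sym (not-involutive (parity w)))
                            (proj₁ (toEdge~base w) (Edge-sym H pp'))))

    base-joined : Connected H → ¬ Bipartite H → base false ~ base true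
    base-joined connH non-bipartite
      with monochromatic-edge H (λ v → parity (connH v a)) (non-bipartite ∘ (_ ,_))
    ... | x , y , xy , same-parity =
      join (parity (connH x a)) (~-trans (~-sym (proj₁ (toEdge~base (connH x a)) xy))
        (subst (λ k → toEdge x y xy ~ base (not k)) (sym same-parity)
               (proj₂ (toEdge~base (connH y a)) xy)))
      where
      join : ∀ k → base k ~ base (not k) → base false ~ base true
      join false = id
      join true  = ~-sym

module TreeMaps {G H : Graph} (v0 : V H) where

  open UniversalCover H

  -- A homomorphism from G to the tree of walks from v0, a walk being adjacent to its
  -- one-step extensions.
  record TreeMap : Set where
    field
      path            : V G → List (V H)
      path-chain      : ∀ x → ChainTo v0 (path x)
      path-neighbours : ∀ x y → Edge G x y → Neighbours (path x) (path y)

  open TreeMap public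

  -- [] is not a chain, so the value of top there is irrelevant.
  top : List (V H) → V H
  top []      = v0
  top (u ∷ _) = u

  top-edge : ∀ {s t} → ChainTo v0 s → ChainTo v0 t → s ⋖ t → Edge H (top s) (top t)
  top-edge {_ ∷ _} _ cht (_ , refl) = Edge-sym H (proj₁ cht)

  isRoot-top : ∀ {l} → ChainTo v0 l → isRoot l ≡ true → top l ≡ v0
  isRoot-top {_ ∷ []} u≡v0 _ = u≡v0

  project : TreeMap → GraphHom G H
  project T = record { fun = top ∘ path T ; pres = pres-top }
    where
    pres-top : ∀ x y → Edge G x y → Edge H (top (path T x)) (top (path T y))
    pres-top x y xy with path-neighbours T x y xy
    ... | inj₁ s⋖t = top-edge (path-chain T x) (path-chain T y) s⋖t
    ... | inj₂ t⋖s = Edge-sym H (top-edge (path-chain T y) (path-chain T x) t⋖s)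

  Height : TreeMap → ℕ → Set
  Height T M = ∀ x → length (path T x) ≤ M

  height-bounded : ∀ T → ∃ (Height T)
  height-bounded T = max 0 lengths , λ x → All.lookup (xs≤max 0 lengths) (∈-tabulate⁺ x)
    where
    lengths : List ℕ
    lengths = tabulate (length ∘ path T)

  prune-chain : ∀ M {l} → ChainTo v0 l → ChainTo v0 (prune M l)
  prune-chain M {[]}            ()
  prune-chain M {_ ∷ []}        ch = ch
  prune-chain M {_ ∷ _ ∷ []}    ch = ch
  prune-chain M {u ∷ w ∷ t ∷ r} ch with length (t ∷ r) ≟ⁿ suc M
  ... | yes _ = proj₂ (proj₂ ch)
  ... | no  _ = ch

  prune-cons : ∀ M u {s} → ChainTo v0 s → Neighbours s (prune M (u ∷ s))
  prune-cons M u {w ∷ []}    _ = inj₁ (u , refl)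
  prune-cons M u {w ∷ t ∷ r} _ with length (t ∷ r) ≟ⁿ suc M
  ... | yes _ = inj₂ (w , refl)
  ... | no  _ = inj₁ (u , refl)

  prune-⋖ : ∀ M {s t} → ChainTo v0 s → length t ≤ suc (suc (suc M)) → s ⋖ t →
            prune M s ≡ s × Neighbours (prune M s) (prune M t)
  prune-⋖ M {s} chs t≤3+M (u , refl) rewrite prune-short M s (≤-pred t≤3+M) =
    refl , prune-cons M u chs

  prune-neighbours : ∀ M {s t} → ChainTo v0 s → ChainTo v0 t →
                     length s ≤ suc (suc (suc M)) → length t ≤ suc (suc (suc M)) →
                     Neighbours s t →
                     (prune M s ≡ s ⊎ prune M t ≡ t) × Neighbours (prune M s) (prune M t)
  prune-neighbours M chs _ _ t≤3+M (inj₁ s⋖t) with prune-⋖ M chs t≤3+M s⋖t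
  ... | fixed , nb = inj₁ fixed , nb
  prune-neighbours M _ cht s≤3+M _ (inj₂ t⋖s) with prune-⋖ M cht s≤3+M t⋖s
  ... | fixed , nb = inj₂ fixed , swap nb

  module _ (M : ℕ) (T : TreeMap) (height : Height T (suc (suc (suc M)))) where

    private
      prune-edge : ∀ x y → Edge G x y →
                   (prune M (path T x) ≡ path T x ⊎ prune M (path T y) ≡ path T y) ×
                   Neighbours (prune M (path T x)) (prune M (path T y))
      prune-edge x y xy = prune-neighbours M (path-chain T x) (path-chain T y)
                                             (height x) (height y) (path-neighbours T x y xy)

    pruneTree : TreeMap
    pruneTree = record
      { path            = prune M ∘ path T
      ; path-chain      = prune-chain M ∘ path-chain T
      ; path-neighbours = λ x y xy → proj₂ (prune-edge x y xy)
      }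

    pruneTree-height : Height pruneTree (suc (suc M))
    pruneTree-height x = prune-height M (path T x) (height x)

    project~pruneTree : project T ~ project pruneTree
    project~pruneTree = agreeOnEdges⇒~ λ x y xy →
      Sum.map (cong top ∘ sym) (cong top ∘ sym) (proj₁ (prune-edge x y xy))

  flatten : ∀ M T → Height T (suc (suc M)) →
            Σ TreeMap λ T' → Height T' 2 × project T ~ project T'
  flatten zero    T height = T , height , ε
  flatten (suc M) T height with flatten M (pruneTree M T height) (pruneTree-height M T height)
  ... | T' , flat , pruned~T' = T' , flat , ~-trans (project~pruneTree M T height) pruned~T'

  isRoot-⋖ : ∀ {s t} → ChainTo v0 s → length t ≤ 2 → s ⋖ t → isRoot s ≢ isRoot t
  isRoot-⋖ {_ ∷ []}    _ _              (_ , refl) ()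
  isRoot-⋖ {_ ∷ _ ∷ _} _ (s≤s (s≤s ())) (_ , refl)

  isRoot-proper : ∀ T → Height T 2 → ProperColouring G (isRoot ∘ path T)
  isRoot-proper T flat x y xy with path-neighbours T x y xy
  ... | inj₁ s⋖t = isRoot-⋖ (path-chain T x) (flat y) s⋖t
  ... | inj₂ t⋖s = isRoot-⋖ (path-chain T y) (flat x) t⋖s ∘ sym

  module _ (c : V G → Bool) (c-proper : ProperColouring G c) where

    open EdgeMaps {G} {H} c c-proper

    -- A height-2 tree map sends one colour class of G to the root v0, and so agrees with a
    -- map onto an edge at v0 on that colour class.
    flat~toEdge : ∀ {x0} → (∀ x → Walk G x0 x) → ∀ {u0} → Edge H v0 u0 →
                  ∀ T → Height T 2 →
                  ∃₂ λ p q → Σ (Edge H p q) λ e → project T ~ toEdge p q e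
    flat~toEdge {x0} walk {u0} v0u0 T flat with c x0 ≟ᵇ isRoot (path T x0)
    ... | yes same = v0 , u0 , v0u0 , agreeOnColourClass⇒~ c-proper true λ x cx≡true →
      let same-x = proper-colourings-agree G c-proper (isRoot-proper T flat) (walk x) same
      in trans (isRoot-top (path-chain T x) (trans (sym same-x) cx≡true))
               (sym (toEdge-true v0u0 cx≡true))
    ... | no differ =
      u0 , v0 , Edge-sym H v0u0 , agreeOnColourClass⇒~ c-proper false λ x cx≡false →
      let opposite-x = proper-colourings-agree G (not-proper G c-proper) (isRoot-proper T flat)
                                               (walk x) (sym (¬-not (differ ∘ sym)))
      in trans (isRoot-top (path-chain T x) (trans (sym opposite-x) (cong not cx≡false)))
               (sym (toEdge-false (Edge-sym H v0u0) cx≡false))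

module _ {G H : Graph} (f : GraphHom G H) (f-trivial : InducesTrivialπ₁ f)
         (connG : Connected G) (x0 : V G) where

  open UniversalCover H
  open TreeMaps {G} {H} (fun f x0)

  private
    spine : ∀ x → Walk H (fun f x0) (fun f x)
    spine x = mapWalk f (connG x0 x)

    stack : V G → List (V H)
    stack x = reduce [] (spine x)

    stack-nonBacktracking : ∀ x → NonBacktracking (fun f x ∷ stack x)
    stack-nonBacktracking x = reduce-preserves (λ a r → NonBacktracking (a ∷ r))
                                               (λ r _ → move-nonBacktracking _ _ r) [] (spine x) tt

    stack-edge : ∀ x y → Edge G x y → move (fun f x) (fun f y) (stack x) ≡ stack y
    stack-edge x y xy =
      reduce-injective back (move-nonBacktracking _ _ _ (stack-nonBacktracking x))
                       (stack-nonBacktracking y) (trans moved-loop (sym back-loop))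
      where
      fxy : Edge H (fun f x) (fun f y)
      fxy = pres f x y xy

      back : Walk H (fun f y) (fun f x0)
      back = spine y ʳ++ nil

      loop : Walk G x0 x0
      loop = connG x0 x ++ cons xy (connG x0 y ʳ++ nil)

      map-loop : mapWalk f loop ≡ spine x ++ cons fxy back
      map-loop = trans (mapWalk-++ f (connG x0 x) _)
                       (cong (λ w → spine x ++ cons fxy w) (mapWalk-ʳ++ f (connG x0 y) nil))

      moved-loop : reduce (move (fun f x) (fun f y) (stack x)) back ≡ []
      moved-loop = begin
        reduce (move (fun f x) (fun f y) (stack x)) back
          ≡⟨ sym (reduce-++ [] (spine x) (cons fxy back)) ⟩
        reduce [] (spine x ++ cons fxy back)
          ≡⟨ cong (reduce []) (sym map-loop) ⟩
        reduce [] (mapWalk f loop)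
          ≡⟨ reduce-homotopic [] tt (f-trivial x0 loop) ⟩
        []
          ∎
        where open ≡-Reasoning

      back-loop : reduce (stack y) back ≡ []
      back-loop = reduce-ʳ++ [] (spine y) nil tt

  lift : TreeMap
  lift = record
    { path            = λ x → fun f x ∷ stack x
    ; path-chain      = λ x → reduce-preserves (λ a r → ChainTo (fun f x0) (a ∷ r))
                                               move-chain [] (spine x) refl
    ; path-neighbours = λ x y xy → subst (λ s → Neighbours (fun f x ∷ stack x) (fun f y ∷ s))
                                         (stack-edge x y xy) (move-neighbours _ _ (stack x))
    }

module _ {G H : Graph} (c : V G → Bool) (c-proper : ProperColouring G c) where

  open EdgeMaps {G} {H} c c-proper

  trivial⇒~toEdge : Connected G → ∀ {x0 y0} → Edge G x0 y0 →
                    ∀ f → InducesTrivialπ₁ f →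
                    ∃₂ λ p q → Σ (Edge H p q) λ e → f ~ toEdge p q e
  trivial⇒~toEdge connG {x0} {y0} x0y0 f f-trivial =
    let M , bounded      = height-bounded L
        L' , flat , L~L' = flatten M L λ x → ≤-trans (bounded x) (m≤n+m M 2)
        p , q , e , L'~e = flat~toEdge c c-proper (connG x0) (pres f x0 y0 x0y0) L' flat
    in p , q , e , ~-trans (agreeOnEdges⇒~ λ _ _ _ → inj₁ refl) (~-trans L~L' L'~e)
    where
    open TreeMaps {G} {H} (fun f x0)

    L : TreeMap
    L = lift f f-trivial connG x0

module Classification {G H : Graph} (c : V G → Bool) (c-proper : ProperColouring G c)
                      (connG : Connected G) {x0 y0 : V G} (x0y0 : Edge G x0 y0)
                      (connH : Connected H) (simple : Simple H) {a b : V H} (ab : Edge H a b) where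

  open EdgeMaps {G} {H} c c-proper

  base-trivialπ₁ : ∀ k → InducesTrivialπ₁ (base ab k)
  base-trivialπ₁ false = toEdge-trivialπ₁ simple ab
  base-trivialπ₁ true  = toEdge-trivialπ₁ simple (Edge-sym H ab)

  trivial~base : ∀ f → InducesTrivialπ₁ f → ∃ λ k → f ~ base ab k
  trivial~base f f-trivial with trivial⇒~toEdge c c-proper connG x0y0 f f-trivial
  ... | p , q , e , f~e =
    parity (connH p a) , ~-trans f~e (proj₁ (toEdge~base ab (connH p a)) e)

  separated⇒twoComponents : ¬ base ab false ~ base ab true → NumTrivialComponents G H 2
  separated⇒twoComponents false≁true =
    base ab ∘ bool , base-trivialπ₁ ∘ bool , separated ,
    λ f f-trivial → covered (trivial~base f f-trivial)
    where
    bool : Fin 2 → Bool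
    bool zero    = false
    bool (suc _) = true

    separated : ∀ i j → i ≢ j → ¬ base ab (bool i) ~ base ab (bool j)
    separated zero       zero       i≢i _ = i≢i refl
    separated (suc zero) (suc zero) i≢i _ = i≢i refl
    separated zero       (suc zero) _     = false≁true
    separated (suc zero) zero       _     = false≁true ∘ ~-sym

    covered : ∀ {f} → ∃ (λ k → f ~ base ab k) → ∃ λ i → f ~ base ab (bool i)
    covered (false , f~) = zero , f~
    covered (true  , f~) = suc zero , f~

  joined⇒oneComponent : base ab false ~ base ab true → NumTrivialComponents G H 1
  joined⇒oneComponent false~true =
    (λ _ → base ab false) , (λ _ → base-trivialπ₁ false) , separated ,
    λ f f-trivial → zero , covered (trivial~base f f-trivial)
    where
    separated : ∀ (i j : Fin 1) → i ≢ j → ¬ base ab false ~ base ab false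
    separated zero zero i≢i _ = i≢i refl

    covered : ∀ {f} → ∃ (λ k → f ~ base ab k) → f ~ base ab false
    covered (false , f~) = f~
    covered (true  , f~) = ~-trans f~ (~-sym false~true)

lemma5p11 : (G H : Graph) →
    Connected G → Bipartite G → HasEdge G →
    Connected H → Simple H → HasEdge H →
    (Bipartite H → NumTrivialComponents G H 2) ×
    (¬ Bipartite H → NumTrivialComponents G H 1)
lemma5p11 G H connG (c , c-proper) (_ , _ , x0y0) connH simple (_ , _ , ab) =
  (λ (d , d-proper) →
     separated⇒twoComponents (toEdge-flip-separated d-proper x0y0 ab (Edge-sym H ab))) ,
  (λ non-bipartite → joined⇒oneComponent (base-joined ab connH non-bipartite))
  where
  open EdgeMaps {G} {H} c c-proper
  open Classification c c-proper connG x0y0 connH simple ab
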